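{- Let $d \geq 2$ and $n \geq 2d+1$ be integers. Then $\sigma^{ -1}(C_n^d) = d(d+1)$.
   Context: For integers $n \geq 3$ and $d \geq 1$, $C_n^d$ (the $d$th power of the cycle $C_n$) is the simple graph with vertex set $\{v_0, \dots, v_{n-1}\}$ in which two distinct vertices $v_i, v_j$ are adjacent if and only if their distance in the $n$-cycle $v_0 v_1 \cdots v_{n-1} v_0$ is at most $d$; equivalently, its edge set is $\{\{v_i, v_{i+j}\} : 0 \le i \le n-1,\ 1 \le j \le d\}$ with indices taken modulo $n$. For a finite graph $G$, the rna number $\sigma^{ -1}(G)$ (also known as the minimum bisection width) is the minimum, over all functions $f: V(G) \to \{1,2\}$ with $\bigl||f^{ -1}(1)| - |f^{ -1}(2)|\bigr| \le 1$, of the number of edges $\{x,y\} \in E(G)$ with $f(x) \neq f(y)$. Equivalently, it is the minimum, over all labelings $v_1,\dots,v_n$ of the vertices of $G$, of the number of edges $\{v_i,v_j\}$ with $i$ and $j$ of different parity. -}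

module Defs where

open import Data.Nat using (ℕ; zero; suc; _+_; _*_; _∸_; _≤_; _<_; _⊓_; ∣_-_∣)
open import Data.Nat.Properties using (_≤?_; _<?_; _≟_)
open import Data.Bool using (Bool; true; false; _∧_; not)
open import Data.Fin using (Fin; toℕ)
open import Data.List using (List; length; filterᵇ; concatMap; map; allFin)
open import Data.Product using (Σ; _×_; _,_)
open import Relation.Nullary.Decidable using (⌊_⌋)
open import Relation.Binary.PropositionalEquality using (_≡_)

-- A finite simple graph on vertex set Fin n, given by a Boolean adjacency relation
-- (assumed symmetric and irreflexive; only pairs i < j are inspected).
record Graph (n : ℕ) : Set where
  field
    adj : Fin n → Fin n → Bool

open Graph public

cycleDist : (n : ℕ) → Fin n → Fin n → ℕ
cycleDist n i j = ∣ toℕ i - toℕ j ∣ ⊓ (n ∸ ∣ toℕ i - toℕ j ∣)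

cyclePower : (n d : ℕ) → Graph n
cyclePower n d = record
  { adj = λ i j → not ⌊ toℕ i ≟ toℕ j ⌋ ∧ ⌊ cycleDist n i j ≤? d ⌋ }

vertexPairs : (n : ℕ) → List (Fin n × Fin n)
vertexPairs n =
  concatMap (λ i → map (λ j → (i , j)) (filterᵇ (λ j → ⌊ toℕ i <? toℕ j ⌋) (allFin n))) (allFin n)

differ : Bool → Bool → Bool
differ true  b = not b
differ false b = b

cutSize : {n : ℕ} → Graph n → (Fin n → Bool) → ℕ
cutSize {n} G f =
  length (filterᵇ (λ { (i , j) → adj G i j ∧ differ (f i) (f j) }) (vertexPairs n))

countTrue : {n : ℕ} → (Fin n → Bool) → ℕ
countTrue {n} f = length (filterᵇ f (allFin n))

Balanced : {n : ℕ} → (Fin n → Bool) → Set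
Balanced {n} f = ∣ countTrue f - (n ∸ countTrue f) ∣ ≤ 1

-- k is the rna number (minimum bisection width) of G:
-- k is attained by some balanced labelling, and no balanced labelling cuts fewer edges.
IsRnaNumber : {n : ℕ} → Graph n → ℕ → Set
IsRnaNumber {n} G k =
  (Σ (Fin n → Bool) λ f → Balanced f × (cutSize G f ≡ k)) ×
  ((f : Fin n → Bool) → Balanced f → k ≤ cutSize G f)

module Submission where

open import Defs
open import Data.Nat.Base
  using (ℕ; zero; suc; _+_; _*_; _∸_; _⊓_; _≤_; _<_; z≤n; s≤s; z<s; s<s; s≤s⁻¹; _<ᵇ_; _≤ᵇ_; _≡ᵇ_; ∣_-_∣; ⌊_/2⌋; ⌈_/2⌉)
open import Data.Nat.Properties
open import Data.Bool.Base using (Bool; true; false; not; _∧_; if_then_else_)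
open import Data.Bool.Properties using (not-involutive)
open import Data.Product using (∃; _×_; _,_; proj₁; proj₂)
open import Data.Sum using (inj₁; inj₂)
open import Data.Fin as Fin using (Fin; toℕ; fromℕ<)
open import Data.Fin.Properties using (fromℕ<-toℕ; toℕ-fromℕ<; toℕ<n)
open import Data.List using (List; []; _∷_; _++_; map; filterᵇ; concatMap; tabulate; allFin; length)
open import Function using (_∘_; id)
open import Algebra.Properties.CommutativeSemigroup +-commutativeSemigroup using () renaming (interchange to +-interchange)
open import Relation.Binary.PropositionalEquality
open import Relation.Binary.Definitions using (tri<; tri≈; tri>)
open import Relation.Nullary using (Dec; yes; no; proof; contradiction)
open import Relation.Nullary.Decidable using (⌊_⌋; isYes≗does)
open import Relation.Nullary.Reflects using (Reflects; ofʸ; ofⁿ; det; fromEquivalence)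

-- Lower bound: label C_{N+1}^d (N ≥ 2d+1) and restrict the labelling to C_N^d. On the first N
-- vertices the two graphs differ only by the d wrap-around edges {i, i + N − d} (i < d) of C_N^d,
-- while the vertex N of C_{N+1}^d carries a star of 2d edges. A cut wrap-around edge forces one of
-- the two star edges from its ends to N to be cut, so restricting never increases the cut. Rotating
-- a vertex of the majority colour to position N keeps the restriction nearly balanced, and we
-- descend to n = 2d+1, where C_n^d is complete and a nearly balanced cut has (d+1)·d edges.
-- Upper bound: the labelling true exactly on [0, ⌊n/2⌋) is built up from K_{2d+1} by adding
-- vertices next to either colour boundary; both arcs of the star of a new vertex are then
-- monochromatic of opposite colours, so it gains d star edges and loses d wrap-around edges.

m<o∸n⇒n<o∸m : ∀ {m n o} → n ≤ o → m < o ∸ n → n < o ∸ m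
m<o∸n⇒n<o∸m {m} {n} {o} n≤o m<o∸n =
  m+n≤o⇒m≤o∸n (suc n) (subst (_≤ o) (cong suc (+-comm m n)) (m≤o∸n⇒m+n≤o (suc m) n≤o m<o∸n))

m≡n∸o⇒n∸m≡o : ∀ {m n o} → o ≤ n → m ≡ n ∸ o → n ∸ m ≡ o
m≡n∸o⇒n∸m≡o {n = n} o≤n refl = m∸[m∸n]≡n o≤n

∣m-n∣≤1⇒m≤1+n : ∀ {m n} → ∣ m - n ∣ ≤ 1 → m ≤ suc n
∣m-n∣≤1⇒m≤1+n {m} {n} ∣m-n∣≤1 =
  ≤-trans (m≤n+∣m-n∣ m n) (≤-trans (+-monoʳ-≤ n ∣m-n∣≤1) (≤-reflexive (+-comm n 1)))

∣⌊n/2⌋-⌈n/2⌉∣≤1 : ∀ n → ∣ ⌊ n /2⌋ - ⌈ n /2⌉ ∣ ≤ 1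
∣⌊n/2⌋-⌈n/2⌉∣≤1 zero          = z≤n
∣⌊n/2⌋-⌈n/2⌉∣≤1 (suc zero)    = s≤s z≤n
∣⌊n/2⌋-⌈n/2⌉∣≤1 (suc (suc n)) = ∣⌊n/2⌋-⌈n/2⌉∣≤1 n

n∸⌊n/2⌋≡⌈n/2⌉ : ∀ n → n ∸ ⌊ n /2⌋ ≡ ⌈ n /2⌉
n∸⌊n/2⌋≡⌈n/2⌉ n = trans (cong (_∸ ⌊ n /2⌋) (sym (⌊n/2⌋+⌈n/2⌉≡n n))) (m+n∸m≡n ⌊ n /2⌋ ⌈ n /2⌉)

m+m≤n⇒m≤⌊n/2⌋ : ∀ {m n} → m + m ≤ n → m ≤ ⌊ n /2⌋
m+m≤n⇒m≤⌊n/2⌋ {m} m+m≤n = subst (_≤ _) (sym (n≡⌊n+n/2⌋ m)) (⌊n/2⌋-mono m+m≤n)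

m+m≤n⇒⌊n/2⌋+m≤n : ∀ {m n} → m + m ≤ n → ⌊ n /2⌋ + m ≤ n
m+m≤n⇒⌊n/2⌋+m≤n {m} {n} m+m≤n =
  ≤-trans (+-monoʳ-≤ ⌊ n /2⌋ (≤-trans (m+m≤n⇒m≤⌊n/2⌋ m+m≤n) (⌊n/2⌋≤⌈n/2⌉ n)))
          (≤-reflexive (⌊n/2⌋+⌈n/2⌉≡n n))

near-half : ∀ d a b → a + b ≡ suc (d + d) → b ≤ suc a → d ≤ a
near-half d a b a+b≡2d+1 b≤1+a = ≮⇒≥ (λ a<d → <⇒≱ (+-mono-< a<d a<d) d+d≤a+a)
  where
  d+d≤a+a : d + d ≤ a + a
  d+d≤a+a = s≤s⁻¹ (≤-trans (≤-reflexive (sym a+b≡2d+1)) (≤-trans (+-monoʳ-≤ a b≤1+a) (≤-reflexive (+-suc a a))))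

near-halves-product : ∀ d a b → a + b ≡ suc (d + d) → d ≤ a → d ≤ b → a * b ≡ d * suc d
near-halves-product d a b a+b≡2d+1 d≤a d≤b with m≤n⇒m<n∨m≡n d≤a
... | inj₂ refl = cong (d *_) (+-cancelˡ-≡ d b (suc d) (trans a+b≡2d+1 (sym (+-suc d d))))
... | inj₁ d<a  = trans (cong₂ _*_ a≡1+d b≡d) (*-comm (suc d) d)
  where
  a≤1+d : a ≤ suc d
  a≤1+d = +-cancelʳ-≤ d a (suc d) (≤-trans (+-monoʳ-≤ a d≤b) (≤-reflexive a+b≡2d+1))
  a≡1+d : a ≡ suc d
  a≡1+d = ≤-antisym a≤1+d d<a
  b≡d : b ≡ d
  b≡d = +-cancelˡ-≡ (suc d) b d (trans (cong (_+ b) (sym a≡1+d)) a+b≡2d+1)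

<ᵇ-true : ∀ {m n} → m < n → (m <ᵇ n) ≡ true
<ᵇ-true {m} {n} m<n = det (<ᵇ-reflects-< m n) (ofʸ m<n)

<ᵇ-false : ∀ {m n} → n ≤ m → (m <ᵇ n) ≡ false
<ᵇ-false {m} {n} n≤m = det (<ᵇ-reflects-< m n) (ofⁿ (≤⇒≯ n≤m))

≤ᵇ-true : ∀ {m n} → m ≤ n → (m ≤ᵇ n) ≡ true
≤ᵇ-true {m} {n} m≤n = det (≤ᵇ-reflects-≤ m n) (ofʸ m≤n)

≤ᵇ-false : ∀ {m n} → n < m → (m ≤ᵇ n) ≡ false
≤ᵇ-false {m} {n} n<m = det (≤ᵇ-reflects-≤ m n) (ofⁿ (<⇒≱ n<m))

≡ᵇ-reflects-≡ : ∀ m n → Reflects (m ≡ n) (m ≡ᵇ n)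
≡ᵇ-reflects-≡ m n = fromEquivalence (≡ᵇ⇒≡ m n) (≡⇒≡ᵇ m n)

≡ᵇ-true : ∀ {m n} → m ≡ n → (m ≡ᵇ n) ≡ true
≡ᵇ-true {m} {n} m≡n = det (≡ᵇ-reflects-≡ m n) (ofʸ m≡n)

≡ᵇ-false : ∀ {m n} → m ≢ n → (m ≡ᵇ n) ≡ false
≡ᵇ-false {m} {n} m≢n = det (≡ᵇ-reflects-≡ m n) (ofⁿ m≢n)

∸≡ᵇsuc : ∀ i j c → ((j ∸ i) ≡ᵇ suc c) ≡ (j ≡ᵇ i + suc c)
∸≡ᵇsuc zero    j       c = refl
∸≡ᵇsuc (suc i) zero    c = refl
∸≡ᵇsuc (suc i) (suc j) c = ∸≡ᵇsuc i j c

⌊⌋-reflects : ∀ {A : Set} {b} (a? : Dec A) → Reflects A b → ⌊ a? ⌋ ≡ b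
⌊⌋-reflects a? r = trans (isYes≗does a?) (det (proof a?) r)

χ : Bool → ℕ
χ true  = 1
χ false = 0

χ-∧ : ∀ a b → χ (a ∧ b) ≡ χ a * χ b
χ-∧ true  b = sym (+-identityʳ (χ b))
χ-∧ false b = refl

differ-comm : ∀ a b → differ a b ≡ differ b a
differ-comm true  true  = refl
differ-comm true  false = refl
differ-comm false true  = refl
differ-comm false false = refl

differ-true : ∀ a → differ a true ≡ not a
differ-true true  = refl
differ-true false = refl

differ-false : ∀ a → differ a false ≡ a
differ-false true  = refl
differ-false false = refl

differ-not : ∀ a b → differ (not a) (not b) ≡ differ a b
differ-not true  true  = refl
differ-not true  false = refl
differ-not false true  = refl
differ-not false false = refl

differ-triangle : ∀ a b x → χ (differ a b) ≤ χ (differ a x) + χ (differ b x)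
differ-triangle true  true  x     = z≤n
differ-triangle false false x     = z≤n
differ-triangle true  false true  = s≤s z≤n
differ-triangle true  false false = s≤s z≤n
differ-triangle false true  true  = s≤s z≤n
differ-triangle false true  false = s≤s z≤n

∑ : ℕ → (ℕ → ℕ) → ℕ
∑ zero    h = 0
∑ (suc n) h = h 0 + ∑ n (h ∘ suc)

∑-cong : ∀ n {g h : ℕ → ℕ} → (∀ i → i < n → g i ≡ h i) → ∑ n g ≡ ∑ n h
∑-cong zero    eq = refl
∑-cong (suc n) eq = cong₂ _+_ (eq 0 z<s) (∑-cong n (λ i i<n → eq (suc i) (s<s i<n)))

∑-mono-≤ : ∀ n {g h : ℕ → ℕ} → (∀ i → i < n → g i ≤ h i) → ∑ n g ≤ ∑ n h
∑-mono-≤ zero    le = z≤n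
∑-mono-≤ (suc n) le = +-mono-≤ (le 0 z<s) (∑-mono-≤ n (λ i i<n → le (suc i) (s<s i<n)))

∑-zero : ∀ n {h : ℕ → ℕ} → (∀ i → i < n → h i ≡ 0) → ∑ n h ≡ 0
∑-zero zero    eq = refl
∑-zero (suc n) eq = cong₂ _+_ (eq 0 z<s) (∑-zero n (λ i i<n → eq (suc i) (s<s i<n)))

∑-const-1 : ∀ n → ∑ n (λ _ → 1) ≡ n
∑-const-1 zero    = refl
∑-const-1 (suc n) = cong suc (∑-const-1 n)

∑-distrib-+ : ∀ n (g h : ℕ → ℕ) → ∑ n (λ i → g i + h i) ≡ ∑ n g + ∑ n h
∑-distrib-+ zero    g h = refl
∑-distrib-+ (suc n) g h =
  trans (cong (g 0 + h 0 +_) (∑-distrib-+ n (g ∘ suc) (h ∘ suc))) (+-interchange (g 0) (h 0) _ _)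

∑-split : ∀ m n (h : ℕ → ℕ) → ∑ (m + n) h ≡ ∑ m h + ∑ n (λ i → h (m + i))
∑-split zero    n h = refl
∑-split (suc m) n h = trans (cong (h 0 +_) (∑-split m n (h ∘ suc))) (sym (+-assoc (h 0) _ _))

∑-suc : ∀ n (h : ℕ → ℕ) → ∑ (suc n) h ≡ ∑ n h + h n
∑-suc zero    h = +-comm (h 0) 0
∑-suc (suc n) h = trans (cong (h 0 +_) (∑-suc n (h ∘ suc))) (sym (+-assoc (h 0) _ _))

∑-arcs : ∀ a r b (h : ℕ → ℕ) → (∀ i → a ≤ i → i < a + r → h i ≡ 0) →
         ∑ (a + r + b) h ≡ ∑ a h + ∑ b (λ i → h (a + r + i))
∑-arcs a r b h gap = begin
  ∑ (a + r + b) h                        ≡⟨ ∑-split (a + r) b h ⟩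
  ∑ (a + r) h + rest                     ≡⟨ cong (_+ rest) (∑-split a r h) ⟩
  ∑ a h + ∑ r (λ i → h (a + i)) + rest   ≡⟨ cong (λ x → ∑ a h + x + rest) gap-sum ⟩
  ∑ a h + 0 + rest                       ≡⟨ cong (_+ rest) (+-identityʳ (∑ a h)) ⟩
  ∑ a h + rest                           ∎
  where
  open ≡-Reasoning
  rest = ∑ b (λ i → h (a + r + i))
  gap-sum : ∑ r (λ i → h (a + i)) ≡ 0
  gap-sum = ∑-zero r (λ i i<r → gap (a + i) (m≤m+n a i) (+-monoʳ-< a i<r))

∑-delta : ∀ n t (h : ℕ → ℕ) → ∑ n (λ j → χ (j ≡ᵇ t) * h j) ≡ χ (t <ᵇ n) * h t
∑-delta zero    t       h = refl
∑-delta (suc n) zero    h = trans (cong (h 0 + 0 +_) (∑-zero n (λ _ _ → refl))) (+-identityʳ _)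
∑-delta (suc n) (suc t) h = ∑-delta n t (h ∘ suc)

∑-χ-< : ∀ n k → k ≤ n → ∑ n (λ i → χ (i <ᵇ k)) ≡ k
∑-χ-< n       zero    _         = ∑-zero n (λ _ _ → refl)
∑-χ-< (suc n) (suc k) (s≤s k≤n) = cong suc (∑-χ-< n k k≤n)

∑-χ+∑-χ-not : ∀ n (p : ℕ → Bool) → ∑ n (χ ∘ p) + ∑ n (χ ∘ not ∘ p) ≡ n
∑-χ+∑-χ-not n p = begin
  ∑ n (χ ∘ p) + ∑ n (χ ∘ not ∘ p)      ≡⟨ ∑-distrib-+ n _ _ ⟨
  ∑ n (λ i → χ (p i) + χ (not (p i)))  ≡⟨ ∑-cong n (λ i _ → χ+χ-not (p i)) ⟩
  ∑ n (λ _ → 1)                        ≡⟨ ∑-const-1 n ⟩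
  n                                    ∎
  where
  open ≡-Reasoning
  χ+χ-not : ∀ b → χ b + χ (not b) ≡ 1
  χ+χ-not true  = refl
  χ+χ-not false = refl

∑-χ-witness : ∀ n (p : ℕ → Bool) → 0 < ∑ n (χ ∘ p) → ∃ λ v → v < n × p v ≡ true
∑-χ-witness (suc n) p pos with p 0 in p0
... | true  = 0 , z<s , p0
... | false with ∑-χ-witness n (p ∘ suc) pos
...   | v , v<n , pv = suc v , s<s v<n , pv

∑< : ℕ → (ℕ → ℕ → ℕ) → ℕ
∑< n P = ∑ n λ i → ∑ n λ j → χ (i <ᵇ j) * P i j

∑<-cong : ∀ n {P Q : ℕ → ℕ → ℕ} → (∀ i j → i < n → j < n → P i j ≡ Q i j) → ∑< n P ≡ ∑< n Q
∑<-cong n eq = ∑-cong n (λ i i<n → ∑-cong n (λ j j<n → cong (χ (i <ᵇ j) *_) (eq i j i<n j<n)))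

∑<-distrib-+ : ∀ n (P Q : ℕ → ℕ → ℕ) → ∑< n (λ i j → P i j + Q i j) ≡ ∑< n P + ∑< n Q
∑<-distrib-+ n P Q = trans
  (∑-cong n (λ i _ → trans (∑-cong n (λ j _ → *-distribˡ-+ (χ (i <ᵇ j)) (P i j) (Q i j))) (∑-distrib-+ n _ _)))
  (∑-distrib-+ n _ _)

∑<-suc : ∀ n (P : ℕ → ℕ → ℕ) → ∑< (suc n) P ≡ ∑< n P + ∑ n (λ i → P i n)
∑<-suc n P = begin
  ∑< (suc n) P
    ≡⟨ ∑-cong (suc n) (λ i _ → ∑-suc n (λ j → χ (i <ᵇ j) * P i j)) ⟩
  ∑ (suc n) (λ i → row i + χ (i <ᵇ n) * P i n)
    ≡⟨ ∑-distrib-+ (suc n) row (λ i → χ (i <ᵇ n) * P i n) ⟩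
  ∑ (suc n) row + ∑ (suc n) (λ i → χ (i <ᵇ n) * P i n)
    ≡⟨ cong₂ _+_ (∑-suc n row) (∑-suc n (λ i → χ (i <ᵇ n) * P i n)) ⟩
  (∑< n P + row n) + (∑ n (λ i → χ (i <ᵇ n) * P i n) + χ (n <ᵇ n) * P n n)
    ≡⟨ cong₂ _+_ (cong (∑< n P +_) last-row-empty)
                 (cong₂ _+_ below-n (cong (λ b → χ b * P n n) (<ᵇ-false {n} ≤-refl))) ⟩
  (∑< n P + 0) + (∑ n (λ i → P i n) + 0)
    ≡⟨ cong₂ _+_ (+-identityʳ (∑< n P)) (+-identityʳ (∑ n (λ i → P i n))) ⟩
  ∑< n P + ∑ n (λ i → P i n)
    ∎
  where
  open ≡-Reasoning
  row : ℕ → ℕ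
  row i = ∑ n (λ j → χ (i <ᵇ j) * P i j)
  last-row-empty : row n ≡ 0
  last-row-empty = ∑-zero n (λ j j<n → cong (λ b → χ b * P n j) (<ᵇ-false (<⇒≤ j<n)))
  below-n : ∑ n (λ i → χ (i <ᵇ n) * P i n) ≡ ∑ n (λ i → P i n)
  below-n = ∑-cong n (λ i i<n → trans (cong (λ b → χ b * P i n) (<ᵇ-true i<n)) (+-identityʳ _))

∑<-suc-first : ∀ n (P : ℕ → ℕ → ℕ) →
               ∑< (suc n) P ≡ ∑ n (λ j → P 0 (suc j)) + ∑< n (λ i j → P (suc i) (suc j))
∑<-suc-first n P = cong (_+ ∑< n (λ i j → P (suc i) (suc j))) (∑-cong n (λ j _ → +-identityʳ _))

∑<-diagonal : ∀ a c (g : ℕ → ℕ → Bool) →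
              ∑< (a + suc c) (λ i j → χ (((j ∸ i) ≡ᵇ suc c) ∧ g i j)) ≡ ∑ a (λ i → χ (g i (i + suc c)))
∑<-diagonal a c g = begin
  ∑< (a + suc c) (λ i j → χ (((j ∸ i) ≡ᵇ suc c) ∧ g i j))
    ≡⟨ ∑-cong (a + suc c) (λ i _ → ∑-cong (a + suc c) (λ j _ → on-diagonal i j)) ⟩
  ∑ (a + suc c) (λ i → ∑ (a + suc c) (λ j → χ (j ≡ᵇ i + suc c) * χ (g i j)))
    ≡⟨ ∑-cong (a + suc c) (λ i _ → ∑-delta (a + suc c) (i + suc c) (λ j → χ (g i j))) ⟩
  ∑ (a + suc c) (λ i → χ (i + suc c <ᵇ a + suc c) * h i)
    ≡⟨ ∑-split a (suc c) _ ⟩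
  ∑ a (λ i → χ (i + suc c <ᵇ a + suc c) * h i) + ∑ (suc c) (λ i → χ (a + i + suc c <ᵇ a + suc c) * h (a + i))
    ≡⟨ cong₂ _+_ (∑-cong a (λ i i<a → trans (cong (λ b → χ b * h i) (<ᵇ-true (+-monoˡ-< (suc c) i<a))) (+-identityʳ (h i))))
                 (∑-zero (suc c) (λ i _ → cong (λ b → χ b * h (a + i)) (<ᵇ-false (+-monoˡ-≤ (suc c) (m≤m+n a i))))) ⟩
  ∑ a h + 0
    ≡⟨ +-identityʳ (∑ a h) ⟩
  ∑ a h
    ∎
  where
  open ≡-Reasoning
  h : ℕ → ℕ
  h i = χ (g i (i + suc c))
  on-diagonal : ∀ i j → χ (i <ᵇ j) * χ (((j ∸ i) ≡ᵇ suc c) ∧ g i j) ≡ χ (j ≡ᵇ i + suc c) * χ (g i j)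
  on-diagonal i j rewrite ∸≡ᵇsuc i j c | χ-∧ (j ≡ᵇ i + suc c) (g i j) with <-cmp i j
  ... | tri< i<j _ _ rewrite <ᵇ-true i<j = +-identityʳ _
  ... | tri≈ _ refl _ rewrite <ᵇ-false {i} ≤-refl | ≡ᵇ-false (m+1+n≢m i {c} ∘ sym) = refl
  ... | tri> _ _ j<i rewrite <ᵇ-false (<⇒≤ j<i)
                          | ≡ᵇ-false {j} {i + suc c} (λ j≡ → m+1+n≰m i (subst (_≤ i) j≡ (<⇒≤ j<i))) = refl

module _ {A : Set} where

  sumList : (A → ℕ) → List A → ℕ
  sumList g []       = 0
  sumList g (x ∷ xs) = g x + sumList g xs

  length-filterᵇ : (p : A → Bool) (xs : List A) → length (filterᵇ p xs) ≡ sumList (χ ∘ p) xs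
  length-filterᵇ p []       = refl
  length-filterᵇ p (x ∷ xs) with p x
  ... | true  = cong suc (length-filterᵇ p xs)
  ... | false = length-filterᵇ p xs

  sumList-filterᵇ : (p : A → Bool) (g : A → ℕ) (xs : List A) →
                    sumList g (filterᵇ p xs) ≡ sumList (λ x → χ (p x) * g x) xs
  sumList-filterᵇ p g []       = refl
  sumList-filterᵇ p g (x ∷ xs) with p x
  ... | true  = cong₂ _+_ (sym (+-identityʳ (g x))) (sumList-filterᵇ p g xs)
  ... | false = sumList-filterᵇ p g xs

  sumList-++ : (g : A → ℕ) (xs ys : List A) → sumList g (xs ++ ys) ≡ sumList g xs + sumList g ys
  sumList-++ g []       ys = refl
  sumList-++ g (x ∷ xs) ys = trans (cong (g x +_) (sumList-++ g xs ys)) (sym (+-assoc (g x) _ _))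

  sumList-tabulate : ∀ {n} (t : Fin n → A) (g : A → ℕ) (h : ℕ → ℕ) →
                     (∀ x → g (t x) ≡ h (toℕ x)) → sumList g (tabulate t) ≡ ∑ n h
  sumList-tabulate {zero}  t g h eq = refl
  sumList-tabulate {suc n} t g h eq =
    cong₂ _+_ (eq Fin.zero) (sumList-tabulate (t ∘ Fin.suc) g (h ∘ suc) (eq ∘ Fin.suc))

module _ {A B : Set} where

  sumList-map : (g : B → ℕ) (f : A → B) (xs : List A) → sumList g (map f xs) ≡ sumList (g ∘ f) xs
  sumList-map g f []       = refl
  sumList-map g f (x ∷ xs) = cong (g (f x) +_) (sumList-map g f xs)

  sumList-concatMap : (g : B → ℕ) (f : A → List B) (xs : List A) →
                      sumList g (concatMap f xs) ≡ sumList (sumList g ∘ f) xs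
  sumList-concatMap g f []       = refl
  sumList-concatMap g f (x ∷ xs) =
    trans (sumList-++ g (f x) (concatMap f xs)) (cong (sumList g (f x) +_) (sumList-concatMap g f xs))

trues : ℕ → (ℕ → Bool) → ℕ
trues n F = ∑ n (χ ∘ F)

falses : ℕ → (ℕ → Bool) → ℕ
falses n F = ∑ n (χ ∘ not ∘ F)

trues-suc : ∀ n (F : ℕ → Bool) → trues (suc n) F ≡ trues n F + χ (F n)
trues-suc n F = ∑-suc n (χ ∘ F)

falses-suc : ∀ n (F : ℕ → Bool) → falses (suc n) F ≡ falses n F + χ (not (F n))
falses-suc n F = ∑-suc n (χ ∘ not ∘ F)

trues+falses : ∀ n (F : ℕ → Bool) → trues n F + falses n F ≡ n
trues+falses n F = ∑-χ+∑-χ-not n F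

falses-complement : ∀ n (F : ℕ → Bool) → falses n (not ∘ F) ≡ trues n F
falses-complement n F = ∑-cong n (λ i _ → cong χ (not-involutive (F i)))

NearlyBalanced : ℕ → (ℕ → Bool) → Set
NearlyBalanced n F = trues n F ≤ suc (falses n F) × falses n F ≤ suc (trues n F)

NearlyBalanced-complement : ∀ n (F : ℕ → Bool) → NearlyBalanced n F → NearlyBalanced n (not ∘ F)
NearlyBalanced-complement n F (t≤1+f , f≤1+t) rewrite falses-complement n F = f≤1+t , t≤1+f

rotate : ℕ → (ℕ → Bool) → ℕ → Bool
rotate n F i = if suc i <ᵇ n then F (suc i) else F 0

rotate-< : ∀ n (F : ℕ → Bool) i → suc i < n → rotate n F i ≡ F (suc i)
rotate-< n F i i+1<n rewrite <ᵇ-true i+1<n = refl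

rotate-last : ∀ m (F : ℕ → Bool) → rotate (suc m) F m ≡ F 0
rotate-last m F rewrite <ᵇ-false {m} ≤-refl = refl

∑-rotate : ∀ m (F : ℕ → Bool) (h : Bool → ℕ) → ∑ (suc m) (h ∘ rotate (suc m) F) ≡ ∑ (suc m) (h ∘ F)
∑-rotate m F h = begin
  ∑ (suc m) (h ∘ rotate (suc m) F)            ≡⟨ ∑-suc m _ ⟩
  ∑ m (h ∘ rotate (suc m) F) + h (rotate (suc m) F m)
    ≡⟨ cong₂ _+_ (∑-cong m (λ i i<m → cong h (rotate-< (suc m) F i (s<s i<m)))) (cong h (rotate-last m F)) ⟩
  ∑ m (h ∘ F ∘ suc) + h (F 0)                 ≡⟨ +-comm _ (h (F 0)) ⟩
  ∑ (suc m) (h ∘ F)                           ∎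
  where open ≡-Reasoning

rotate^ : ℕ → ℕ → (ℕ → Bool) → ℕ → Bool
rotate^ n zero    F = F
rotate^ n (suc k) F = rotate n (rotate^ n k F)

rotate^-< : ∀ n k (F : ℕ → Bool) i → i + k < n → rotate^ n k F i ≡ F (i + k)
rotate^-< n zero    F i i<n = cong F (sym (+-identityʳ i))
rotate^-< n (suc k) F i i+k+1<n = begin
  rotate n (rotate^ n k F) i   ≡⟨ rotate-< n (rotate^ n k F) i (≤-<-trans (s≤s (m≤m+n i k)) i+1+k<n) ⟩
  rotate^ n k F (suc i)        ≡⟨ rotate^-< n k F (suc i) i+1+k<n ⟩
  F (suc i + k)                ≡⟨ cong F (+-suc i k) ⟨
  F (i + suc k)                ∎
  where
  open ≡-Reasoning
  i+1+k<n : suc i + k < n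
  i+1+k<n = subst (_< n) (+-suc i k) i+k+1<n

rotate^-last : ∀ m v (F : ℕ → Bool) → v < suc m → rotate^ (suc m) (suc v) F m ≡ F v
rotate^-last m v F v<m+1 = trans (rotate-last m (rotate^ (suc m) v F)) (rotate^-< (suc m) v F 0 v<m+1)

∑-rotate^ : ∀ m k (F : ℕ → Bool) (h : Bool → ℕ) → ∑ (suc m) (h ∘ rotate^ (suc m) k F) ≡ ∑ (suc m) (h ∘ F)
∑-rotate^ m zero    F h = refl
∑-rotate^ m (suc k) F h = trans (∑-rotate m (rotate^ (suc m) k F) h) (∑-rotate^ m k F h)

interval : ℕ → ℕ → Bool
interval k i = i <ᵇ k

extend : ∀ {n} → (Fin n → Bool) → ℕ → Bool
extend {n} f i with i <? n
... | yes i<n = f (fromℕ< i<n)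
... | no  _   = false

extend-toℕ : ∀ {n} (f : Fin n → Bool) (x : Fin n) → extend f (toℕ x) ≡ f x
extend-toℕ {n} f x with toℕ x <? n
... | yes x<n = cong f (fromℕ<-toℕ x x<n)
... | no  x≮n = contradiction (toℕ<n x) x≮n

extend-∘toℕ : ∀ {n} (g : ℕ → Bool) i → i < n → extend {n} (g ∘ toℕ) i ≡ g i
extend-∘toℕ {n} g i i<n with i <? n
... | yes i<n′ = cong g (toℕ-fromℕ< i<n′)
... | no  i≮n  = contradiction i<n i≮n

countTrue-extend : ∀ n (f : Fin n → Bool) → countTrue f ≡ trues n (extend f)
countTrue-extend n f = trans (length-filterᵇ f (allFin n))
  (sumList-tabulate id (χ ∘ f) (χ ∘ extend f) (λ x → cong χ (sym (extend-toℕ f x))))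

falses-extend : ∀ n (f : Fin n → Bool) → falses n (extend f) ≡ n ∸ countTrue f
falses-extend n f = begin
  falses n (extend f)                    ≡⟨ m+n∸m≡n (trues n (extend f)) _ ⟨
  trues n (extend f) + falses n (extend f) ∸ trues n (extend f)
                                         ≡⟨ cong₂ _∸_ (trues+falses n (extend f)) (sym (countTrue-extend n f)) ⟩
  n ∸ countTrue f                        ∎
  where open ≡-Reasoning

Balanced⇒NearlyBalanced : ∀ n (f : Fin n → Bool) → Balanced f → NearlyBalanced n (extend f)
Balanced⇒NearlyBalanced n f balanced rewrite sym (countTrue-extend n f) | falses-extend n f =
  ∣m-n∣≤1⇒m≤1+n balanced , ∣m-n∣≤1⇒m≤1+n (subst (_≤ 1) (∣-∣-comm (countTrue f) _) balanced)

countTrue-interval : ∀ n k → k ≤ n → countTrue {n} (interval k ∘ toℕ) ≡ k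
countTrue-interval n k k≤n = trans (length-filterᵇ (interval k ∘ toℕ) (allFin n))
  (trans (sumList-tabulate {n = n} id (χ ∘ interval k ∘ toℕ) (χ ∘ interval k) (λ _ → refl)) (∑-χ-< n k k≤n))

Balanced-half : ∀ n → Balanced {n} (interval ⌊ n /2⌋ ∘ toℕ)
Balanced-half n rewrite countTrue-interval n ⌊ n /2⌋ (⌊n/2⌋≤n n) | n∸⌊n/2⌋≡⌈n/2⌉ n = ∣⌊n/2⌋-⌈n/2⌉∣≤1 n

module CyclePower (d : ℕ) where

  adjacent : ℕ → ℕ → Bool
  adjacent n δ = (δ ⊓ (n ∸ δ)) ≤ᵇ d

  -- Labellings are total functions ℕ → Bool; only their values below n matter.
  cutEdge : ℕ → (ℕ → Bool) → ℕ → ℕ → ℕ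
  cutEdge n F i j = χ (adjacent n (j ∸ i) ∧ differ (F i) (F j))

  cut : ℕ → (ℕ → Bool) → ℕ
  cut n F = ∑< n (cutEdge n F)

  adjacent-short : ∀ n δ → δ ≤ d → adjacent n δ ≡ true
  adjacent-short n δ δ≤d = ≤ᵇ-true (≤-trans (m⊓n≤m δ (n ∸ δ)) δ≤d)

  adjacent-around : ∀ n δ → n ∸ δ ≤ d → adjacent n δ ≡ true
  adjacent-around n δ n∸δ≤d = ≤ᵇ-true (≤-trans (m⊓n≤n δ (n ∸ δ)) n∸δ≤d)

  adjacent-far : ∀ n δ → d < δ → d < n ∸ δ → adjacent n δ ≡ false
  adjacent-far n δ d<δ d<n∸δ = ≤ᵇ-false (⊓-pres-m< d<δ d<n∸δ)

  adjacent-sym : ∀ n δ → δ ≤ n → adjacent n (n ∸ δ) ≡ adjacent n δ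
  adjacent-sym n δ δ≤n = cong (_≤ᵇ d) (trans (cong ((n ∸ δ) ⊓_) (m∸[m∸n]≡n δ≤n)) (⊓-comm (n ∸ δ) δ))

  adjacent-complete : ∀ n δ → n ≤ suc (d + d) → adjacent n δ ≡ true
  adjacent-complete n δ n≤2d+1 with δ ≤? d
  ... | yes δ≤d = adjacent-short n δ δ≤d
  ... | no  δ≰d = adjacent-around n δ (≤-trans (∸-mono n≤2d+1 (≰⇒> δ≰d)) (≤-reflexive (m+n∸n≡m d d)))

  cut-cong : ∀ n {F G : ℕ → Bool} → (∀ i → i < n → F i ≡ G i) → cut n F ≡ cut n G
  cut-cong n eq = ∑<-cong n (λ i j i<n j<n →
    cong₂ (λ a b → χ (adjacent n (j ∸ i) ∧ differ a b)) (eq i i<n) (eq j j<n))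

  cut-complement : ∀ n (F : ℕ → Bool) → cut n (not ∘ F) ≡ cut n F
  cut-complement n F = ∑<-cong n (λ i j _ _ → cong (λ b → χ (adjacent n (j ∸ i) ∧ b)) (differ-not (F i) (F j)))

  cut-rotate : ∀ m (F : ℕ → Bool) → cut (suc m) (rotate (suc m) F) ≡ cut (suc m) F
  cut-rotate m F = begin
    cut (suc m) G
      ≡⟨ ∑<-suc m (cutEdge (suc m) G) ⟩
    ∑< m (λ i j → χ (adjacent (suc m) (j ∸ i) ∧ differ (G i) (G j)))
      + ∑ m (λ i → χ (adjacent (suc m) (m ∸ i) ∧ differ (G i) (G m)))
      ≡⟨ cong₂ _+_ (∑<-cong m inner) (∑-cong m to-first) ⟩
    ∑< m (λ i j → χ (adjacent (suc m) (j ∸ i) ∧ differ (F (suc i)) (F (suc j))))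
      + ∑ m (λ j → χ (adjacent (suc m) (suc j) ∧ differ (F 0) (F (suc j))))
      ≡⟨ +-comm (∑< m (λ i j → cutEdge (suc m) F (suc i) (suc j))) _ ⟩
    ∑ m (λ j → χ (adjacent (suc m) (suc j) ∧ differ (F 0) (F (suc j))))
      + ∑< m (λ i j → χ (adjacent (suc m) (j ∸ i) ∧ differ (F (suc i)) (F (suc j))))
      ≡⟨ ∑<-suc-first m (cutEdge (suc m) F) ⟨
    cut (suc m) F
      ∎
    where
    open ≡-Reasoning
    G = rotate (suc m) F
    G-< : ∀ i → i < m → G i ≡ F (suc i)
    G-< i i<m = rotate-< (suc m) F i (s<s i<m)
    inner : ∀ i j → i < m → j < m → χ (adjacent (suc m) (j ∸ i) ∧ differ (G i) (G j))
                                    ≡ χ (adjacent (suc m) (j ∸ i) ∧ differ (F (suc i)) (F (suc j)))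
    inner i j i<m j<m = cong₂ (λ a b → χ (adjacent (suc m) (j ∸ i) ∧ differ a b)) (G-< i i<m) (G-< j j<m)
    to-first : ∀ i → i < m → χ (adjacent (suc m) (m ∸ i) ∧ differ (G i) (G m))
                             ≡ χ (adjacent (suc m) (suc i) ∧ differ (F 0) (F (suc i)))
    to-first i i<m = cong₂ (λ a b → χ (a ∧ b)) (adjacent-sym (suc m) (suc i) (s≤s (<⇒≤ i<m)))
      (trans (cong₂ differ (G-< i i<m) (rotate-last m F)) (differ-comm (F (suc i)) (F 0)))

  cut-rotate^ : ∀ m k (F : ℕ → Bool) → cut (suc m) (rotate^ (suc m) k F) ≡ cut (suc m) F
  cut-rotate^ m zero    F = refl
  cut-rotate^ m (suc k) F = trans (cut-rotate m (rotate^ (suc m) k F)) (cut-rotate^ m k F)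

  -- Deleting the last vertex

  d≤N : ∀ {N} → suc (d + d) ≤ N → d ≤ N
  d≤N 2d+1≤N = ≤-trans (m≤m+n d d) (≤-trans (n≤1+n (d + d)) 2d+1≤N)

  d<N∸d : ∀ {N} → suc (d + d) ≤ N → d < N ∸ d
  d<N∸d {N} 2d+1≤N = subst (_≤ N ∸ d) (m+n∸n≡m (suc d) d) (∸-monoˡ-≤ d 2d+1≤N)

  adjacent-drop : ∀ N δ x → suc (d + d) ≤ N → δ ≤ N →
                  χ (adjacent N δ ∧ x) ≡ χ (adjacent (suc N) δ ∧ x) + χ ((δ ≡ᵇ N ∸ d) ∧ x)
  adjacent-drop N δ x 2d+1≤N δ≤N with δ ≤? d
  ... | yes δ≤d
    rewrite adjacent-short N δ δ≤d | adjacent-short (suc N) δ δ≤d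
          | ≡ᵇ-false {δ} {N ∸ d} (λ δ≡N∸d → <⇒≱ (d<N∸d 2d+1≤N) (subst (_≤ d) δ≡N∸d δ≤d))
    = sym (+-identityʳ (χ x))
  ... | no δ≰d with <-cmp (N ∸ δ) d | +-∸-assoc 1 δ≤N
  ...   | tri< N∸δ<d _ _ | 1+N∸δ
    rewrite adjacent-around N δ (<⇒≤ N∸δ<d) | adjacent-around (suc N) δ (subst (_≤ d) (sym 1+N∸δ) N∸δ<d)
          | ≡ᵇ-false {δ} {N ∸ d} (λ δ≡N∸d → <-irrefl (m≡n∸o⇒n∸m≡o (d≤N 2d+1≤N) δ≡N∸d) N∸δ<d)
    = sym (+-identityʳ (χ x))
  ...   | tri≈ _ N∸δ≡d _ | 1+N∸δ
    rewrite adjacent-around N δ (≤-reflexive N∸δ≡d)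
          | adjacent-far (suc N) δ (≰⇒> δ≰d) (≤-reflexive (sym (trans 1+N∸δ (cong suc N∸δ≡d))))
          | ≡ᵇ-true (sym (m≡n∸o⇒n∸m≡o δ≤N (sym N∸δ≡d)))
    = refl
  ...   | tri> _ _ d<N∸δ | 1+N∸δ
    rewrite adjacent-far N δ (≰⇒> δ≰d) d<N∸δ
          | adjacent-far (suc N) δ (≰⇒> δ≰d) (subst (d <_) (sym 1+N∸δ) (m<n⇒m<1+n d<N∸δ))
          | ≡ᵇ-false {δ} {N ∸ d} (λ δ≡N∸d → <-irrefl (sym (m≡n∸o⇒n∸m≡o (d≤N 2d+1≤N) δ≡N∸d)) d<N∸δ)
    = refl

  -- The edges {i, i + (N ∸ d)}, i < d, of C_N^d that C_{N+1}^d does not have.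
  wrapCut : ℕ → (ℕ → Bool) → ℕ
  wrapCut N F = ∑ d (λ i → χ (differ (F i) (F (i + (N ∸ d)))))

  starCut : ℕ → (ℕ → Bool) → ℕ
  starCut N F = ∑ N (λ i → cutEdge (suc N) F i N)

  cut-suc : ∀ N (F : ℕ → Bool) → cut (suc N) F ≡ ∑< N (cutEdge (suc N) F) + starCut N F
  cut-suc N F = ∑<-suc N (cutEdge (suc N) F)

  wrapCut-diagonal : ∀ N (F : ℕ → Bool) → d < N →
    ∑< N (λ i j → χ (((j ∸ i) ≡ᵇ N ∸ d) ∧ differ (F i) (F j))) ≡ ∑ d (λ i → χ (differ (F i) (F (i + (N ∸ d)))))
  wrapCut-diagonal N F d<N with N ∸ d | m+[n∸m]≡n (<⇒≤ d<N)
  ... | zero  | d+0≡N = contradiction (trans (sym (+-identityʳ d)) d+0≡N) (<⇒≢ d<N)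
  ... | suc c | refl  = ∑<-diagonal d c (λ i j → differ (F i) (F j))

  cut-via-suc : ∀ N (F : ℕ → Bool) → suc (d + d) ≤ N → cut N F ≡ ∑< N (cutEdge (suc N) F) + wrapCut N F
  cut-via-suc N F 2d+1≤N = begin
    cut N F
      ≡⟨ ∑<-cong N (λ i j _ j<N →
           adjacent-drop N (j ∸ i) (differ (F i) (F j)) 2d+1≤N (≤-trans (m∸n≤m j i) (<⇒≤ j<N))) ⟩
    ∑< N (λ i j → cutEdge (suc N) F i j + χ (((j ∸ i) ≡ᵇ N ∸ d) ∧ differ (F i) (F j)))
      ≡⟨ ∑<-distrib-+ N (cutEdge (suc N) F) _ ⟩
    ∑< N (cutEdge (suc N) F) + ∑< N (λ i j → χ (((j ∸ i) ≡ᵇ N ∸ d) ∧ differ (F i) (F j)))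
      ≡⟨ cong (∑< N (cutEdge (suc N) F) +_) (wrapCut-diagonal N F (≤-trans (s≤s (m≤m+n d d)) 2d+1≤N)) ⟩
    ∑< N (cutEdge (suc N) F) + wrapCut N F
      ∎
    where open ≡-Reasoning

  starCut-arcs : ∀ N (F : ℕ → Bool) → d + d ≤ N →
    starCut N F ≡ ∑ d (λ i → χ (differ (F i) (F N))) + ∑ d (λ i → χ (differ (F (i + (N ∸ d))) (F N)))
  starCut-arcs N F 2d≤N = begin
    ∑ N h                                        ≡⟨ cong (λ M → ∑ M h) (sym N≡d+r+d) ⟩
    ∑ (d + r + d) h                              ≡⟨ ∑-arcs d r d h middle ⟩
    ∑ d h + ∑ d (λ i → h (d + r + i))            ≡⟨ cong₂ _+_ (∑-cong d first) (∑-cong d last) ⟩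
    ∑ d (λ i → χ (differ (F i) (F N))) + ∑ d (λ i → χ (differ (F (i + (N ∸ d))) (F N)))  ∎
    where
    open ≡-Reasoning
    h : ℕ → ℕ
    h i = cutEdge (suc N) F i N
    r : ℕ
    r = N ∸ d ∸ d
    d≤N∸d : d ≤ N ∸ d
    d≤N∸d = m+n≤o⇒m≤o∸n d 2d≤N
    d+r≡N∸d : d + r ≡ N ∸ d
    d+r≡N∸d = m+[n∸m]≡n d≤N∸d
    N≡d+r+d : d + r + d ≡ N
    d≤N′ : d ≤ N
    d≤N′ = ≤-trans (m≤m+n d d) 2d≤N
    N≡d+r+d = trans (cong (_+ d) d+r≡N∸d) (m∸n+n≡m d≤N′)
    i<N : ∀ {i} → i < N ∸ d → i < N
    i<N i<N∸d = ≤-trans i<N∸d (m∸n≤m N d)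
    star-sym : ∀ i → i < N → adjacent (suc N) (N ∸ i) ≡ adjacent (suc N) (suc i)
    star-sym i i<N = adjacent-sym (suc N) (suc i) (s≤s (<⇒≤ i<N))
    middle : ∀ i → d ≤ i → i < d + r → h i ≡ 0
    middle i d≤i i<d+r = cong (λ b → χ (b ∧ differ (F i) (F N)))
      (trans (star-sym i (i<N i<N∸d)) (adjacent-far (suc N) (suc i) (s≤s d≤i) (m<o∸n⇒n<o∸m d≤N′ i<N∸d)))
      where
      i<N∸d : i < N ∸ d
      i<N∸d = subst (i <_) d+r≡N∸d i<d+r
    first : ∀ i → i < d → h i ≡ χ (differ (F i) (F N))
    first i i<d = cong (λ b → χ (b ∧ differ (F i) (F N)))
      (trans (star-sym i (<-≤-trans i<d d≤N′)) (adjacent-short (suc N) (suc i) i<d))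
    last : ∀ i → i < d → h (d + r + i) ≡ χ (differ (F (i + (N ∸ d))) (F N))
    last i _ rewrite d+r≡N∸d | +-comm (N ∸ d) i = cong (λ b → χ (b ∧ differ (F (i + (N ∸ d))) (F N)))
      (adjacent-short (suc N) (N ∸ (i + (N ∸ d)))
        (≤-trans (∸-monoʳ-≤ N (m≤n+m (N ∸ d) i)) (≤-reflexive (m∸[m∸n]≡n d≤N′))))

  -- {i, i + (N ∸ d)} can only be cut if {i, N} or {i + (N ∸ d), N} is, and these star edges are
  -- all distinct.
  wrapCut≤starCut : ∀ N (F : ℕ → Bool) → d + d ≤ N → wrapCut N F ≤ starCut N F
  wrapCut≤starCut N F 2d≤N = begin
    wrapCut N F
      ≤⟨ ∑-mono-≤ d (λ i _ → differ-triangle (F i) (F (i + (N ∸ d))) (F N)) ⟩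
    ∑ d (λ i → χ (differ (F i) (F N)) + χ (differ (F (i + (N ∸ d))) (F N)))
      ≡⟨ ∑-distrib-+ d _ _ ⟩
    ∑ d (λ i → χ (differ (F i) (F N))) + ∑ d (λ i → χ (differ (F (i + (N ∸ d))) (F N)))
      ≡⟨ starCut-arcs N F 2d≤N ⟨
    starCut N F
      ∎
    where open ≤-Reasoning

  cut-extend-≤ : ∀ N (F : ℕ → Bool) → suc (d + d) ≤ N → cut N F ≤ cut (suc N) F
  cut-extend-≤ N F 2d+1≤N = begin
    cut N F                                       ≡⟨ cut-via-suc N F 2d+1≤N ⟩
    ∑< N (cutEdge (suc N) F) + wrapCut N F        ≤⟨ +-monoʳ-≤ _ (wrapCut≤starCut N F (≤-trans (n≤1+n _) 2d+1≤N)) ⟩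
    ∑< N (cutEdge (suc N) F) + starCut N F        ≡⟨ cut-suc N F ⟨
    cut (suc N) F                                 ∎
    where open ≤-Reasoning

  cut-extend-≡ : ∀ N (F : ℕ → Bool) → suc (d + d) ≤ N → wrapCut N F ≡ starCut N F → cut (suc N) F ≡ cut N F
  cut-extend-≡ N F 2d+1≤N wrap≡star = begin
    cut (suc N) F                                 ≡⟨ cut-suc N F ⟩
    ∑< N (cutEdge (suc N) F) + starCut N F        ≡⟨ cong (∑< N (cutEdge (suc N) F) +_) wrap≡star ⟨
    ∑< N (cutEdge (suc N) F) + wrapCut N F        ≡⟨ cut-via-suc N F 2d+1≤N ⟨
    cut N F                                       ∎
    where open ≡-Reasoning

  -- Lower bound

  cut-complete : ∀ m (F : ℕ → Bool) → m ≤ suc (d + d) → cut m F ≡ trues m F * falses m F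
  cut-complete zero    F _         = refl
  cut-complete (suc m) F m+1≤2d+1 = begin
    cut (suc m) F
      ≡⟨ cut-suc m F ⟩
    ∑< m (cutEdge (suc m) F) + starCut m F
      ≡⟨ cong₂ _+_ (∑<-cong m (λ i j _ _ → cong (λ b → χ (b ∧ differ (F i) (F j))) (same-edges j i)))
                   (∑-cong m (λ i _ → cong (λ b → χ (b ∧ differ (F i) (F m)))
                                          (adjacent-complete (suc m) (m ∸ i) m+1≤2d+1))) ⟩
    cut m F + ∑ m (λ i → χ (differ (F i) (F m)))
      ≡⟨ cong (_+ ∑ m (λ i → χ (differ (F i) (F m)))) (cut-complete m F (≤-trans (n≤1+n m) m+1≤2d+1)) ⟩
    trues m F * falses m F + ∑ m (λ i → χ (differ (F i) (F m)))
      ≡⟨ add-vertex (F m) ⟩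
    (trues m F + χ (F m)) * (falses m F + χ (not (F m)))
      ≡⟨ cong₂ _*_ (trues-suc m F) (falses-suc m F) ⟨
    trues (suc m) F * falses (suc m) F
      ∎
    where
    open ≡-Reasoning
    same-edges : ∀ j i → adjacent (suc m) (j ∸ i) ≡ adjacent m (j ∸ i)
    same-edges j i = trans (adjacent-complete (suc m) (j ∸ i) m+1≤2d+1)
                           (sym (adjacent-complete m (j ∸ i) (≤-trans (n≤1+n m) m+1≤2d+1)))
    a = trues m F
    b = falses m F
    add-vertex : ∀ x → a * b + ∑ m (λ i → χ (differ (F i) x)) ≡ (a + χ x) * (b + χ (not x))
    add-vertex true  = begin
      a * b + ∑ m (λ i → χ (differ (F i) true))  ≡⟨ cong (a * b +_) (∑-cong m (λ i _ → cong χ (differ-true (F i)))) ⟩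
      a * b + b                                  ≡⟨ cong (a * b +_) (*-identityˡ b) ⟨
      a * b + 1 * b                              ≡⟨ *-distribʳ-+ b a 1 ⟨
      (a + 1) * b                                ≡⟨ cong ((a + 1) *_) (+-identityʳ b) ⟨
      (a + 1) * (b + 0)                          ∎
    add-vertex false = begin
      a * b + ∑ m (λ i → χ (differ (F i) false)) ≡⟨ cong (a * b +_) (∑-cong m (λ i _ → cong χ (differ-false (F i)))) ⟩
      a * b + a                                  ≡⟨ cong (a * b +_) (*-identityʳ a) ⟨
      a * b + a * 1                              ≡⟨ *-distribˡ-+ a b 1 ⟨
      a * (b + 1)                                ≡⟨ cong (_* (b + 1)) (+-identityʳ a) ⟨
      (a + 0) * (b + 1)                          ∎

  cut-complete-balanced : ∀ (F : ℕ → Bool) → NearlyBalanced (suc (d + d)) F → cut (suc (d + d)) F ≡ d * suc d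
  cut-complete-balanced F (a≤1+b , b≤1+a) = begin
    cut (suc (d + d)) F  ≡⟨ cut-complete (suc (d + d)) F ≤-refl ⟩
    a * b                ≡⟨ near-halves-product d a b a+b (near-half d a b a+b b≤1+a) (near-half d b a b+a a≤1+b) ⟩
    d * suc d            ∎
    where
    open ≡-Reasoning
    a = trues (suc (d + d)) F
    b = falses (suc (d + d)) F
    a+b : a + b ≡ suc (d + d)
    a+b = trues+falses (suc (d + d)) F
    b+a : b + a ≡ suc (d + d)
    b+a = trans (+-comm b a) a+b

  -- Rotate a true vertex, which exists since true is the majority colour, to position N and delete it.
  cut-lower-bound-step : ∀ N → suc (d + d) ≤ N → (∀ G → NearlyBalanced N G → d * suc d ≤ cut N G) →
                         ∀ F → NearlyBalanced (suc N) F → falses (suc N) F ≤ trues (suc N) F →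
                         d * suc d ≤ cut (suc N) F
  cut-lower-bound-step N 2d+1≤N IH F (t≤1+f , _) f≤t = begin
    d * suc d       ≤⟨ IH G G-balanced ⟩
    cut N G         ≤⟨ cut-extend-≤ N G 2d+1≤N ⟩
    cut (suc N) G   ≡⟨ cut-rotate^ N (suc v) F ⟩
    cut (suc N) F   ∎
    where
    open ≤-Reasoning
    t = trues (suc N) F
    f = falses (suc N) F
    t-positive : 0 < t
    t-positive = n≢0⇒n>0 (λ t≡0 → <⇒≱ z<s (begin
      suc N    ≡⟨ trues+falses (suc N) F ⟨
      t + f    ≤⟨ +-monoʳ-≤ t f≤t ⟩
      t + t    ≡⟨ cong₂ _+_ t≡0 t≡0 ⟩
      0        ∎))
    some-true : ∃ λ v → v < suc N × F v ≡ true
    some-true = ∑-χ-witness (suc N) F t-positive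
    v = proj₁ some-true
    G = rotate^ (suc N) (suc v) F
    G-last : G N ≡ true
    G-last = trans (rotate^-last N v F (proj₁ (proj₂ some-true))) (proj₂ (proj₂ some-true))
    trues-G : trues N G + 1 ≡ t
    trues-G = begin-equality
      trues N G + 1            ≡⟨ cong (λ b → trues N G + χ b) G-last ⟨
      trues N G + χ (G N)      ≡⟨ trues-suc N G ⟨
      trues (suc N) G          ≡⟨ ∑-rotate^ N (suc v) F χ ⟩
      t                        ∎
    falses-G : falses N G + 0 ≡ f
    falses-G = begin-equality
      falses N G + 0             ≡⟨ cong (λ b → falses N G + χ (not b)) G-last ⟨
      falses N G + χ (not (G N)) ≡⟨ falses-suc N G ⟨
      falses (suc N) G           ≡⟨ ∑-rotate^ N (suc v) F (χ ∘ not) ⟩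
      f                          ∎
    G-balanced : NearlyBalanced N G
    G-balanced = (begin
      trues N G             ≤⟨ m≤m+n (trues N G) 1 ⟩
      trues N G + 1         ≡⟨ trues-G ⟩
      t                     ≤⟨ t≤1+f ⟩
      suc f                 ≡⟨ cong suc (trans (sym falses-G) (+-identityʳ _)) ⟩
      suc (falses N G)      ∎) , (begin
      falses N G            ≡⟨ +-identityʳ _ ⟨
      falses N G + 0        ≡⟨ falses-G ⟩
      f                     ≤⟨ f≤t ⟩
      t                     ≡⟨ trues-G ⟨
      trues N G + 1         ≡⟨ +-comm (trues N G) 1 ⟩
      suc (trues N G)       ∎)

  cut-lower-bound : ∀ n → suc (d + d) ≤ n → ∀ F → NearlyBalanced n F → d * suc d ≤ cut n F
  cut-lower-bound (suc N) 2d+1≤N+1 F balanced with m≤n⇒m<n∨m≡n 2d+1≤N+1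
  ... | inj₂ refl = ≤-reflexive (sym (cut-complete-balanced F balanced))
  ... | inj₁ 2d+1<N+1 with falses (suc N) F ≤? trues (suc N) F
  ...   | yes f≤t = cut-lower-bound-step N (s≤s⁻¹ 2d+1<N+1) (cut-lower-bound N (s≤s⁻¹ 2d+1<N+1)) F balanced f≤t
  ...   | no  f≰t = subst (d * suc d ≤_) (cut-complement (suc N) F)
    (cut-lower-bound-step N (s≤s⁻¹ 2d+1<N+1) (cut-lower-bound N (s≤s⁻¹ 2d+1<N+1)) (not ∘ F)
      (NearlyBalanced-complement (suc N) F balanced) f′≤t′)
    where
    f′≤t′ : falses (suc N) (not ∘ F) ≤ trues (suc N) (not ∘ F)
    f′≤t′ = subst (_≤ falses (suc N) F) (sym (falses-complement (suc N) F)) (<⇒≤ (≰⇒> f≰t))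

  -- Upper bound

  -- Both arcs of the star of N are monochromatic, of opposite colours.
  module _ {N k} {F : ℕ → Bool} (2d+1≤N : suc (d + d) ≤ N) (d≤k : d ≤ k) (k+d≤N : k + d ≤ N)
           (F≈interval : ∀ i → i < N → F i ≡ interval k i) where

    private
      first-arc-true : ∀ i → i < d → F i ≡ true
      first-arc-true i i<d = trans (F≈interval i (<-≤-trans i<d (d≤N 2d+1≤N))) (<ᵇ-true (<-≤-trans i<d d≤k))

      last-arc-false : ∀ i → i < d → F (i + (N ∸ d)) ≡ false
      last-arc-false i i<d = trans (F≈interval (i + (N ∸ d)) i+N∸d<N)
                                   (<ᵇ-false (≤-trans (m+n≤o⇒m≤o∸n k k+d≤N) (m≤n+m (N ∸ d) i)))
        where
        i+N∸d<N : i + (N ∸ d) < N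
        i+N∸d<N = subst (i + (N ∸ d) <_) (m+[n∸m]≡n (d≤N 2d+1≤N)) (+-monoˡ-< (N ∸ d) i<d)

    wrapCut-interval : wrapCut N F ≡ d
    wrapCut-interval = trans
      (∑-cong d (λ i i<d → cong₂ (λ a b → χ (differ a b)) (first-arc-true i i<d) (last-arc-false i i<d)))
      (∑-const-1 d)

    starCut-interval : starCut N F ≡ d
    starCut-interval = begin
      starCut N F
        ≡⟨ starCut-arcs N F (≤-trans (n≤1+n (d + d)) 2d+1≤N) ⟩
      ∑ d (λ i → χ (differ (F i) (F N))) + ∑ d (λ i → χ (differ (F (i + (N ∸ d))) (F N)))
        ≡⟨ cong₂ _+_ (∑-cong d (λ i i<d → cong (λ a → χ (differ a (F N))) (first-arc-true i i<d)))
                     (∑-cong d (λ i i<d → cong (λ a → χ (differ a (F N))) (last-arc-false i i<d))) ⟩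
      ∑ d (λ _ → χ (differ true (F N))) + ∑ d (λ _ → χ (differ false (F N)))
        ≡⟨ one-arc-cut (F N) ⟩
      d ∎
      where
      open ≡-Reasoning
      one-arc-cut : ∀ x → ∑ d (λ _ → χ (differ true x)) + ∑ d (λ _ → χ (differ false x)) ≡ d
      one-arc-cut true  = cong₂ _+_ (∑-zero d (λ _ _ → refl)) (∑-const-1 d)
      one-arc-cut false = trans (cong₂ _+_ (∑-const-1 d) (∑-zero d (λ _ _ → refl))) (+-identityʳ d)

    cut-extend-interval : cut (suc N) F ≡ cut N F
    cut-extend-interval = cut-extend-≡ N F 2d+1≤N (trans wrapCut-interval (sym starCut-interval))

  cut-interval-complete : ∀ k → d ≤ k → k + d ≤ suc (d + d) → cut (suc (d + d)) (interval k) ≡ d * suc d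
  cut-interval-complete k d≤k k+d≤N = begin
    cut N (interval k)                            ≡⟨ cut-complete N (interval k) ≤-refl ⟩
    trues N (interval k) * falses N (interval k)  ≡⟨ cong₂ _*_ trues≡k falses≡N∸k ⟩
    k * (N ∸ k)                                   ≡⟨ near-halves-product d k (N ∸ k) (m+[n∸m]≡n k≤N) d≤k d≤N∸k ⟩
    d * suc d                                     ∎
    where
    open ≡-Reasoning
    N = suc (d + d)
    k≤N : k ≤ N
    k≤N = ≤-trans (m≤m+n k d) k+d≤N
    d≤N∸k : d ≤ N ∸ k
    d≤N∸k = m+n≤o⇒m≤o∸n d (subst (_≤ N) (+-comm k d) k+d≤N)
    trues≡k : trues N (interval k) ≡ k
    trues≡k = ∑-χ-< N k k≤N
    falses≡N∸k : falses N (interval k) ≡ N ∸ k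
    falses≡N∸k = trans (sym (m+n∸m≡n (trues N (interval k)) _)) (cong₂ _∸_ (trues+falses N (interval k)) trues≡k)

  cut-interval-extend-true : ∀ M k → suc (d + d) ≤ M → d ≤ k → k + d ≤ M →
                             cut (suc M) (interval (suc k)) ≡ cut M (interval k)
  cut-interval-extend-true M k 2d+1≤M d≤k k+d≤M = begin
    cut (suc M) (interval (suc k))       ≡⟨ cut-rotate M (interval (suc k)) ⟨
    cut (suc M) G                        ≡⟨ cut-extend-interval 2d+1≤M d≤k k+d≤M G≈interval ⟩
    cut M G                              ≡⟨ cut-cong M G≈interval ⟩
    cut M (interval k)                   ∎
    where
    open ≡-Reasoning
    G = rotate (suc M) (interval (suc k))
    G≈interval : ∀ i → i < M → G i ≡ interval k i
    G≈interval i i<M = rotate-< (suc M) (interval (suc k)) i (s<s i<M)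

  cut-interval : ∀ N k → suc (d + d) ≤ N → d ≤ k → k + d ≤ N → cut N (interval k) ≡ d * suc d
  cut-interval (suc M) k 2d+1≤N d≤k k+d≤N with m≤n⇒m<n∨m≡n 2d+1≤N
  ... | inj₂ refl = cut-interval-complete k d≤k k+d≤N
  ... | inj₁ 2d+2≤N with k + d ≤? M
  ...   | yes k+d≤M =
    trans (cut-extend-interval 2d+1≤M d≤k k+d≤M (λ _ _ → refl)) (cut-interval M k 2d+1≤M d≤k k+d≤M)
    where
    2d+1≤M = s≤s⁻¹ 2d+2≤N
  ...   | no  k+d≰M = begin
    cut (suc M) (interval k)              ≡⟨ cong (cut (suc M) ∘ interval) k≡1+k′ ⟩
    cut (suc M) (interval (suc k′))       ≡⟨ cut-interval-extend-true M k′ 2d+1≤M d≤k′ (≤-reflexive k′+d≡M) ⟩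
    cut M (interval k′)                   ≡⟨ cut-interval M k′ 2d+1≤M d≤k′ (≤-reflexive k′+d≡M) ⟩
    d * suc d                             ∎
    where
    open ≡-Reasoning
    2d+1≤M = s≤s⁻¹ 2d+2≤N
    k′ = M ∸ d
    d≤k′ : d ≤ k′
    d≤k′ = <⇒≤ (d<N∸d 2d+1≤M)
    k′+d≡M : k′ + d ≡ M
    k′+d≡M = m∸n+n≡m (d≤N 2d+1≤M)
    k≡1+k′ : k ≡ suc k′
    k≡1+k′ = begin
      k                 ≡⟨ m+n∸n≡m k d ⟨
      k + d ∸ d         ≡⟨ cong (_∸ d) (≤-antisym k+d≤N (≰⇒> k+d≰M)) ⟩
      suc M ∸ d         ≡⟨ +-∸-assoc 1 (d≤N 2d+1≤M) ⟩
      suc k′            ∎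

  adjacent-cyclePower : ∀ {n} (x y : Fin n) → toℕ x < toℕ y →
                        adj (cyclePower n d) x y ≡ adjacent n (toℕ y ∸ toℕ x)
  adjacent-cyclePower {n} x y x<y
    rewrite ⌊⌋-reflects (toℕ x ≟ toℕ y) (≡ᵇ-reflects-≡ (toℕ x) (toℕ y)) | ≡ᵇ-false (<⇒≢ x<y)
          | ⌊⌋-reflects (cycleDist n x y ≤? d) (≤ᵇ-reflects-≤ (cycleDist n x y) d)
          | m≤n⇒∣m-n∣≡n∸m (<⇒≤ x<y) = refl

  cutSize-pair : ∀ {n} (f : Fin n → Bool) (x y : Fin n) →
    χ ⌊ toℕ x <? toℕ y ⌋ * χ (adj (cyclePower n d) x y ∧ differ (f x) (f y))
      ≡ χ (toℕ x <ᵇ toℕ y) * cutEdge n (extend f) (toℕ x) (toℕ y)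
  cutSize-pair f x y rewrite ⌊⌋-reflects (toℕ x <? toℕ y) (<ᵇ-reflects-< (toℕ x) (toℕ y)) with toℕ x <? toℕ y
  ... | no  x≮y rewrite <ᵇ-false (≮⇒≥ x≮y) = refl
  ... | yes x<y rewrite <ᵇ-true x<y | adjacent-cyclePower x y x<y | extend-toℕ f x | extend-toℕ f y = refl

  cutSize-cyclePower : ∀ n (f : Fin n → Bool) → cutSize (cyclePower n d) f ≡ cut n (extend f)
  cutSize-cyclePower n f =
    trans (length-filterᵇ isCut (vertexPairs n))
   (trans (sumList-concatMap (χ ∘ isCut) later (allFin n))
          (sumList-tabulate id (sumList (χ ∘ isCut) ∘ later) (λ a → ∑ n (pairTerm a)) row))
    where
    isCut : Fin n × Fin n → Bool
    isCut (x , y) = adj (cyclePower n d) x y ∧ differ (f x) (f y)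
    later : Fin n → List (Fin n × Fin n)
    later x = map (x ,_) (filterᵇ (λ y → ⌊ toℕ x <? toℕ y ⌋) (allFin n))
    pairTerm : ℕ → ℕ → ℕ
    pairTerm a b = χ (a <ᵇ b) * cutEdge n (extend f) a b
    row : ∀ x → sumList (χ ∘ isCut) (later x) ≡ ∑ n (pairTerm (toℕ x))
    row x = trans (sumList-map (χ ∘ isCut) (x ,_) (filterᵇ (λ y → ⌊ toℕ x <? toℕ y ⌋) (allFin n)))
           (trans (sumList-filterᵇ (λ y → ⌊ toℕ x <? toℕ y ⌋) (λ y → χ (isCut (x , y))) (allFin n))
                  (sumList-tabulate id _ (pairTerm (toℕ x)) (cutSize-pair f x)))

  cutSize-interval : ∀ n k → suc (d + d) ≤ n → d ≤ k → k + d ≤ n →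
                     cutSize (cyclePower n d) (interval k ∘ toℕ) ≡ d * suc d
  cutSize-interval n k 2d+1≤n d≤k k+d≤n = begin
    cutSize (cyclePower n d) f   ≡⟨ cutSize-cyclePower n f ⟩
    cut n (extend f)             ≡⟨ cut-cong n (extend-∘toℕ (interval k)) ⟩
    cut n (interval k)           ≡⟨ cut-interval n k 2d+1≤n d≤k k+d≤n ⟩
    d * suc d                    ∎
    where
    open ≡-Reasoning
    f : Fin n → Bool
    f = interval k ∘ toℕ

  cutSize-lower-bound : ∀ n → suc (d + d) ≤ n → (f : Fin n → Bool) → Balanced f →
                        d * suc d ≤ cutSize (cyclePower n d) f
  cutSize-lower-bound n 2d+1≤n f balanced = subst (d * suc d ≤_) (sym (cutSize-cyclePower n f))
    (cut-lower-bound n 2d+1≤n (extend f) (Balanced⇒NearlyBalanced n f balanced))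

theorem1 : (n d : ℕ) → 2 ≤ d → 2 * d + 1 ≤ n → IsRnaNumber (cyclePower n d) (d * (d + 1))
theorem1 n d _ 2d+1≤n = (half , Balanced-half n , half-cut) , lower-bound
  where
  open CyclePower d
  2d+1≤n′ : suc (d + d) ≤ n
  2d+1≤n′ = subst (_≤ n) (trans (+-comm (2 * d) 1) (cong (λ m → suc (d + m)) (+-identityʳ d))) 2d+1≤n
  d+d≤n : d + d ≤ n
  d+d≤n = ≤-trans (n≤1+n (d + d)) 2d+1≤n′
  d*[d+1] : d * suc d ≡ d * (d + 1)
  d*[d+1] = cong (d *_) (+-comm 1 d)
  half : Fin n → Bool
  half = interval ⌊ n /2⌋ ∘ toℕ
  half-cut : cutSize (cyclePower n d) half ≡ d * (d + 1)
  half-cut = trans (cutSize-interval n ⌊ n /2⌋ 2d+1≤n′ (m+m≤n⇒m≤⌊n/2⌋ d+d≤n) (m+m≤n⇒⌊n/2⌋+m≤n d+d≤n))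
                   d*[d+1]
  lower-bound : ∀ f → Balanced f → d * (d + 1) ≤ cutSize (cyclePower n d) f
  lower-bound f balanced = subst (_≤ cutSize (cyclePower n d) f) d*[d+1] (cutSize-lower-bound n 2d+1≤n′ f balanced)
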